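{- Let $m,n$ be positive integers, $N=mn$ and $c_{m,n}=\frac{(N-2)(n-1)}{2}$. Let $Y_{m,n}$ be the set of tuples $(\lambda_1,\dots,\lambda_N)\in\mathbb{Z}^N$ with $n-1\ge\lambda_1\ge\cdots\ge\lambda_N\ge 0$ and $\sum_i\lambda_i\equiv c_{m,n}\pmod n$. Let $B_{m,n}$ be the set of words $w=w_1\cdots w_{(m+1)n}\in\{0,1\}^{(m+1)n}$ with exactly $n$ zeros and $mn$ ones, $w_1=0$, and $\sum_{i:\,w_i=1}i\equiv -1\pmod n$. Then $|B_{m,n}|=|Y_{m,n}|$. -}

module Defs where

open import Level using (0ℓ)
open import Data.Nat using (ℕ; zero; suc; _+_; _*_; _∸_; _≤_; NonZero)
open import Data.Nat.DivMod using (_/_; _%_)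
open import Data.Bool using (Bool; true; false; if_then_else_)
import Data.Bool as Bool
open import Data.Fin using (Fin; toℕ)
import Data.Fin as Fin
open import Data.Vec using (Vec; []; _∷_; lookup; tabulate; sum; count)
open import Data.Product using (Σ; _×_; proj₁)
open import Data.Empty using (⊥)
open import Relation.Binary.Bundles using (Setoid)
open import Relation.Binary.PropositionalEquality using (_≡_)
import Relation.Binary.PropositionalEquality as ≡
import Relation.Binary.Construct.On as On
open import Function.Bundles using (Inverse)

SubsetSetoid : (A : Set) → (A → Set) → Setoid 0ℓ 0ℓ
SubsetSetoid A P = On.setoid {B = Σ A P} (≡.setoid A) proj₁

SameCard : (A : Set) → (A → Set) → (B : Set) → (B → Set) → Set
SameCard A P B Q = Inverse (SubsetSetoid A P) (SubsetSetoid B Q)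

-- c_{m,n} = (N-2)(n-1)/2 with N = m n (always an integer; for m = n = 1
-- the value is 0 both in ℤ and with truncated subtraction).
c : ℕ → ℕ → ℕ
c m n = ((m * n ∸ 2) * (n ∸ 1)) / 2

-- Y_{m,n}: λ ∈ ℤ^N (here ℕ^N, since λ_N ≥ 0 forces all entries ≥ 0)
-- with n-1 ≥ λ_1 ≥ ... ≥ λ_N ≥ 0 and Σ λ_i ≡ c_{m,n} (mod n).
InY : (m n : ℕ) → .{{_ : NonZero n}} → Vec ℕ (m * n) → Set
InY m n l =
  (∀ (i : Fin (m * n)) → lookup l i ≤ n ∸ 1)
  × (∀ (i j : Fin (m * n)) → i Fin.≤ j → lookup l j ≤ lookup l i)
  × (sum l % n ≡ c m n % n)

-- First letter of a word is 0 (true encodes the letter 1, false the letter 0).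
FirstIsZero : ∀ {k} → Vec Bool k → Set
FirstIsZero []      = ⊥
FirstIsZero (x ∷ _) = x ≡ false

posSum : ∀ {k} → Vec Bool k → ℕ
posSum {k} w = sum (tabulate (λ (i : Fin k) → if lookup w i then suc (toℕ i) else 0))

-- B_{m,n}: words of length (m+1)n with n zeros, mn ones, w_1 = 0,
-- and Σ_{w_i = 1} i ≡ -1 (mod n), i.e. n ∣ (Σ + 1).
InB : (m n : ℕ) → .{{_ : NonZero n}} → Vec Bool (suc m * n) → Set
InB m n w =
  (count (Bool._≟ false) w ≡ n)
  × (count (Bool._≟ true) w ≡ m * n)
  × FirstIsZero w
  × ((posSum w + 1) % n ≡ 0)

module Submission where

-- Write a word of B as 0w. Recording, for each letter 1 of w, the number of zeros
-- after it is the classical bijection between words with n - 1 zeros and N ones and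
-- partitions λ with N parts at most n - 1. The j-th letter 1 of 0w, having λ_j zeros
-- after it, sits at position j + (n - λ_j), so Σ_{w_i = 1} i + Σ λ = N(N+1)/2 + N n.
-- Hence Σ_{w_i = 1} i ≡ -1 iff Σ λ ≡ 1 + N(N+1)/2 (mod n), and the latter is
-- c_{m,n} modulo n since 1 + N(N+1)/2 - c_{m,n} = n (n m(m-1)/2 + m + 1).

open import Data.Bool using (Bool; true; false; if_then_else_)
import Data.Bool as Bool
open import Data.Empty using (⊥; ⊥-elim; ⊥-elim-irr)
open import Data.Fin using (Fin; toℕ)
import Data.Fin as Fin
open import Data.Nat using (ℕ; zero; suc; pred; _+_; _*_; _≤_; _≟_; z≤n; s≤s; NonZero)
open import Data.Nat.Properties
open import Data.Nat.DivMod
open import Data.Nat.Divisibility using (divides; m%n≡0⇒n∣m; n∣m⇒m%n≡0; ∣m+n∣m⇒∣n; n∣m*n)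
open import Data.Nat.Tactic.RingSolver using (solve-∀)
open import Data.Product using (_×_; _,_)
open import Data.Unit using (⊤; tt)
open import Data.Vec using (Vec; []; _∷_; sum; count; lookup; tabulate)
open import Data.Vec.Properties using (tabulate-cong)
open import Function.Bundles using (_⇔_; mk⇔; Equivalence)
open import Relation.Nullary using (yes; no)
open import Relation.Binary.PropositionalEquality
open ≡-Reasoning
open import Defs

zeros ones : ∀ {k} → Vec Bool k → ℕ
zeros = count (Bool._≟ false)
ones  = count (Bool._≟ true)

zeros+ones≡length : ∀ {k} (w : Vec Bool k) → zeros w + ones w ≡ k
zeros+ones≡length []          = refl
zeros+ones≡length (false ∷ w) = cong suc (zeros+ones≡length w)
zeros+ones≡length (true  ∷ w) = trans (+-suc (zeros w) (ones w)) (cong suc (zeros+ones≡length w))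

Decreasing≤ : ℕ → ∀ {b} → Vec ℕ b → Set
Decreasing≤ a []      = ⊤
Decreasing≤ a (x ∷ v) = x ≤ a × Decreasing≤ x v

Decreasing≤-weaken : ∀ {a a′ b} (v : Vec ℕ b) → a ≤ a′ → Decreasing≤ a v → Decreasing≤ a′ v
Decreasing≤-weaken []      _    _          = tt
Decreasing≤-weaken (x ∷ v) a≤a′ (x≤a , dv) = ≤-trans x≤a a≤a′ , dv

Decreasing≤⇒lookup≤ : ∀ {a b} (v : Vec ℕ b) → Decreasing≤ a v → ∀ i → lookup v i ≤ a
Decreasing≤⇒lookup≤ (x ∷ v) (x≤a , dv) Fin.zero    = x≤a
Decreasing≤⇒lookup≤ (x ∷ v) (x≤a , dv) (Fin.suc i) = ≤-trans (Decreasing≤⇒lookup≤ v dv i) x≤a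

Decreasing≤⇒lookup-antitone : ∀ {a b} (v : Vec ℕ b) → Decreasing≤ a v →
                              ∀ i j → i Fin.≤ j → lookup v j ≤ lookup v i
Decreasing≤⇒lookup-antitone (x ∷ v) (_ , dv) Fin.zero    Fin.zero    _         = ≤-refl
Decreasing≤⇒lookup-antitone (x ∷ v) (_ , dv) Fin.zero    (Fin.suc j) _         = Decreasing≤⇒lookup≤ v dv j
Decreasing≤⇒lookup-antitone (x ∷ v) (_ , dv) (Fin.suc i) (Fin.suc j) (s≤s i≤j) = Decreasing≤⇒lookup-antitone v dv i j i≤j

lookup⇒Decreasing≤ : ∀ {a b} (v : Vec ℕ b) → (∀ i → lookup v i ≤ a) →
                     (∀ i j → i Fin.≤ j → lookup v j ≤ lookup v i) → Decreasing≤ a v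
lookup⇒Decreasing≤ []      _      _        = tt
lookup⇒Decreasing≤ (x ∷ v) bound antitone =
  bound Fin.zero ,
  lookup⇒Decreasing≤ v (λ i → antitone Fin.zero (Fin.suc i) z≤n)
                       (λ i j i≤j → antitone (Fin.suc i) (Fin.suc j) (s≤s i≤j))

-- The j-th entry of partition b w is the number of zeros after the j-th letter 1
-- of w; the result is padded with 0 or truncated when w does not have b ones.
partition : ∀ {k} (b : ℕ) → Vec Bool k → Vec ℕ b
partition b       (false ∷ w) = partition b w
partition zero    []          = []
partition (suc b) []          = 0 ∷ partition b []
partition zero    (true ∷ w)  = []
partition (suc b) (true ∷ w)  = zeros w ∷ partition b w

-- The word of length k with a zeros whose partition is v: read v from the left,
-- writing 1 when its next entry equals the number of zeros still to be written.
word : (k a : ℕ) → ∀ {b} → Vec ℕ b → Vec Bool k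
word zero    a v = []
word (suc k) a [] = false ∷ word k (pred a) []
word (suc k) a (x ∷ v) with x ≟ a
... | yes _ = true ∷ word k a v
... | no  _ = false ∷ word k (pred a) (x ∷ v)

partition-decreasing : ∀ {k} (w : Vec Bool k) → Decreasing≤ (zeros w) (partition (ones w) w)
partition-decreasing []          = tt
partition-decreasing (false ∷ w) =
  Decreasing≤-weaken (partition (ones w) w) (n≤1+n (zeros w)) (partition-decreasing w)
partition-decreasing (true ∷ w)  = ≤-refl , partition-decreasing w

word-suc : ∀ k a {b} (v : Vec ℕ b) → Decreasing≤ a v → word (suc k) (suc a) v ≡ false ∷ word k a v
word-suc k a []      _         = refl
word-suc k a (x ∷ v) (x≤a , _) with x ≟ suc a
... | yes refl = ⊥-elim (1+n≰n x≤a)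
... | no  _    = refl

word-partition : ∀ {k} (w : Vec Bool k) → word k (zeros w) (partition (ones w) w) ≡ w
word-partition []          = refl
word-partition (false ∷ w) = begin
  word _ (suc (zeros w)) (partition (ones w) w)   ≡⟨ word-suc _ (zeros w) _ (partition-decreasing w) ⟩
  false ∷ word _ (zeros w) (partition (ones w) w) ≡⟨ cong (false ∷_) (word-partition w) ⟩
  false ∷ w                                       ∎
word-partition (true ∷ w) with zeros w ≟ zeros w
... | yes _   = cong (true ∷_) (word-partition w)
... | no  z≢z = ⊥-elim (z≢z refl)

≤∧≢suc⇒≤ : ∀ {x a} → x ≤ suc a → x ≢ suc a → x ≤ a
≤∧≢suc⇒≤ x≤1+a x≢1+a = ≤-pred (≤∧≢⇒< x≤1+a x≢1+a)

≤∧≢0⇒⊥ : ∀ {x} → x ≤ 0 → x ≢ 0 → ⊥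
≤∧≢0⇒⊥ x≤0 x≢0 = x≢0 (n≤0⇒n≡0 x≤0)

zeros-word : ∀ k a {b} (v : Vec ℕ b) → Decreasing≤ a v → b + a ≡ k → zeros (word k a v) ≡ a
zeros-word zero    zero []      _          refl = refl
zeros-word (suc k) a    []      _          refl = cong suc (zeros-word k (pred a) [] tt refl)
zeros-word (suc k) a    (x ∷ v) (x≤a , dv) e    with x ≟ a
... | yes refl = zeros-word k x v dv (suc-injective e)
zeros-word (suc k) zero    (x ∷ v) (x≤0 , dv) e | no x≢0 = ⊥-elim (≤∧≢0⇒⊥ x≤0 x≢0)
zeros-word (suc k) (suc a) (x ∷ v) (x≤a , dv) e | no x≢a =
  cong suc (zeros-word k a (x ∷ v) (≤∧≢suc⇒≤ x≤a x≢a , dv) (suc-injective (trans (sym (+-suc _ a)) e)))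

ones-word : ∀ k a {b} (v : Vec ℕ b) → Decreasing≤ a v → b + a ≡ k → ones (word k a v) ≡ b
ones-word k a {b} v dv e = +-cancelˡ-≡ a _ _ (begin
  a + ones (word k a v)                  ≡⟨ cong (_+ ones (word k a v)) (sym (zeros-word k a v dv e)) ⟩
  zeros (word k a v) + ones (word k a v) ≡⟨ zeros+ones≡length (word k a v) ⟩
  k                                      ≡⟨ trans (sym e) (+-comm b a) ⟩
  a + b                                  ∎)

partition-word : ∀ k a {b} (v : Vec ℕ b) → Decreasing≤ a v → b + a ≡ k → partition b (word k a v) ≡ v
partition-word zero    zero []      _          refl = refl
partition-word (suc k) a    []      _          refl = partition-word k (pred a) [] tt refl
partition-word (suc k) a    (x ∷ v) (x≤a , dv) e    with x ≟ a
... | yes refl = cong₂ _∷_ (zeros-word k x v dv (suc-injective e)) (partition-word k x v dv (suc-injective e))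
partition-word (suc k) zero    (x ∷ v) (x≤0 , dv) e | no x≢0 = ⊥-elim (≤∧≢0⇒⊥ x≤0 x≢0)
partition-word (suc k) (suc a) (x ∷ v) (x≤a , dv) e | no x≢a =
  partition-word k a (x ∷ v) (≤∧≢suc⇒≤ x≤a x≢a , dv) (suc-injective (trans (sym (+-suc _ a)) e))

triangular : ℕ → ℕ
triangular zero    = 0
triangular (suc k) = suc k + triangular k

2*triangular : ∀ k → 2 * triangular k ≡ k * suc k
2*triangular zero    = refl
2*triangular (suc k) = begin
  2 * (suc k + triangular k)         ≡⟨ *-distribˡ-+ 2 (suc k) (triangular k) ⟩
  2 * suc k + 2 * triangular k       ≡⟨ cong (2 * suc k +_) (2*triangular k) ⟩
  2 * suc k + k * suc k              ≡⟨ step k ⟩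
  suc k * suc (suc k)                ∎
  where
  step : ∀ k → 2 * suc k + k * suc k ≡ suc k * suc (suc k)
  step = solve-∀

posSumFrom : ∀ {k} → ℕ → Vec Bool k → ℕ
posSumFrom o []      = 0
posSumFrom o (x ∷ w) = (if x then suc o else 0) + posSumFrom (suc o) w

sum-positions≡posSumFrom : ∀ {k} o (w : Vec Bool k) →
  sum (tabulate (λ (i : Fin k) → if lookup w i then suc (o + toℕ i) else 0)) ≡ posSumFrom o w
sum-positions≡posSumFrom o []      = refl
sum-positions≡posSumFrom o (x ∷ w) = cong₂ _+_
  (cong (λ p → if x then suc p else 0) (+-identityʳ o))
  (trans (cong sum (tabulate-cong (λ i → cong (λ p → if lookup w i then suc p else 0) (+-suc o (toℕ i)))))
         (sum-positions≡posSumFrom (suc o) w))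

posSumFrom+sum-partition : ∀ {k} o (w : Vec Bool k) →
  posSumFrom o w + sum (partition (ones w) w) ≡ ones w * o + triangular (ones w) + ones w * zeros w
posSumFrom+sum-partition o []          = refl
posSumFrom+sum-partition o (false ∷ w) =
  trans (posSumFrom+sum-partition (suc o) w) (shift (ones w) o (triangular (ones w)) (zeros w))
  where
  shift : ∀ b o t z → b * suc o + t + b * z ≡ b * o + t + b * suc z
  shift = solve-∀
posSumFrom+sum-partition o (true ∷ w)  = begin
  (suc o + posSumFrom (suc o) w) + (z + sum (partition b w))  ≡⟨ regroup o z _ _ ⟩
  suc o + z + (posSumFrom (suc o) w + sum (partition b w))    ≡⟨ cong (suc o + z +_) (posSumFrom+sum-partition (suc o) w) ⟩
  suc o + z + (b * suc o + triangular b + b * z)              ≡⟨ collect o z b (triangular b) ⟩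
  suc b * o + (suc b + triangular b) + suc b * z              ∎
  where
  b = ones w
  z = zeros w
  regroup : ∀ o z p s → (suc o + p) + (z + s) ≡ suc o + z + (p + s)
  regroup = solve-∀
  collect : ∀ o z b t → suc o + z + (b * suc o + t + b * z) ≡ suc b * o + (suc b + t) + suc b * z
  collect = solve-∀

%≡0⇔%≡% : ∀ a b d q n .{{_ : NonZero n}} → a + b ≡ d + q * n → (a % n ≡ 0 ⇔ b % n ≡ d % n)
%≡0⇔%≡% a b d q n a+b≡d+qn = mk⇔ to from
  where
  to : a % n ≡ 0 → b % n ≡ d % n
  to a%n≡0 = begin
    b % n           ≡⟨ %-remove-+ˡ b (m%n≡0⇒n∣m a n a%n≡0) ⟨
    (a + b) % n     ≡⟨ cong (_% n) a+b≡d+qn ⟩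
    (d + q * n) % n ≡⟨ [m+kn]%n≡m%n d q n ⟩
    d % n           ∎
  from : b % n ≡ d % n → a % n ≡ 0
  from b%n≡d%n = n∣m⇒m%n≡0 a n (∣m+n∣m⇒∣n (divides (d / n + q) (+-cancelʳ-≡ (b % n) _ _ eq)) (n∣m*n (b / n)))
    where
    swap : ∀ s m x r → s * m + x + r ≡ x + (r + s * m)
    swap = solve-∀
    collect : ∀ r s q m → r + s * m + q * m ≡ (s + q) * m + r
    collect = solve-∀
    eq : b / n * n + a + b % n ≡ (d / n + q) * n + b % n
    eq = begin
      b / n * n + a + b % n          ≡⟨ swap (b / n) n a (b % n) ⟩
      a + (b % n + b / n * n)        ≡⟨ cong (a +_) (m≡m%n+[m/n]*n b n) ⟨
      a + b                          ≡⟨ a+b≡d+qn ⟩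
      d + q * n                      ≡⟨ cong (_+ q * n) (m≡m%n+[m/n]*n d n) ⟩
      d % n + d / n * n + q * n      ≡⟨ collect (d % n) (d / n) q n ⟩
      (d / n + q) * n + d % n        ≡⟨ cong ((d / n + q) * n +_) b%n≡d%n ⟨
      (d / n + q) * n + b % n        ∎

-- For n ≥ 2 the truncated subtractions in c m n are exact, so c m n = E / 2 with E
-- below; doubling then makes the identity polynomial.
c+multiple≡1+triangular : ∀ m′ n″ → let m = suc m′; n = 2 + n″ in
  c m n + (n * triangular m′ + m + 1) * n ≡ 1 + triangular (m * n)
c+multiple≡1+triangular m′ n″ = begin
  E / 2 + Y                  ≡⟨ cong (E / 2 +_) (m*n/n≡m Y 2) ⟨
  E / 2 + Y * 2 / 2          ≡⟨ +-distrib-/-∣ʳ E (divides Y refl) ⟨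
  (E + Y * 2) / 2            ≡⟨ cong (_/ 2) doubled ⟩
  (1 + triangular N) * 2 / 2 ≡⟨ m*n/n≡m (1 + triangular N) 2 ⟩
  1 + triangular N           ∎
  where
  m n N E Y : ℕ
  m = suc m′
  n = 2 + n″
  N = m * n
  E = (n″ + m′ * n) * suc n″
  Y = (n * triangular m′ + m + 1) * n
  expand : ∀ e n m t → e + (n * t + m + 1) * n * 2 ≡ e + n * n * (2 * t) + 2 * n * suc m
  expand = solve-∀
  collect : ∀ m′ n″ → let m = suc m′; n = 2 + n″; N = m * n in
    (n″ + m′ * n) * suc n″ + n * n * (m′ * m) + 2 * n * suc m ≡ 2 + N * suc N
  collect = solve-∀
  double : ∀ t → 2 + 2 * t ≡ (1 + t) * 2
  double = solve-∀
  doubled : E + Y * 2 ≡ (1 + triangular N) * 2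
  doubled = begin
    E + Y * 2                                       ≡⟨ expand E n m (triangular m′) ⟩
    E + n * n * (2 * triangular m′) + 2 * n * suc m ≡⟨ cong (λ t → E + n * n * t + 2 * n * suc m) (2*triangular m′) ⟩
    E + n * n * (m′ * m) + 2 * n * suc m            ≡⟨ collect m′ n″ ⟩
    2 + N * suc N                                   ≡⟨ cong (2 +_) (2*triangular N) ⟨
    2 + 2 * triangular N                            ≡⟨ double (triangular N) ⟩
    (1 + triangular N) * 2                          ∎

[1+triangular[mn]]%n≡c%n : ∀ m′ n .{{_ : NonZero n}} → (1 + triangular (suc m′ * n)) % n ≡ c (suc m′) n % n
[1+triangular[mn]]%n≡c%n m′ 1                = trans (n%1≡0 (1 + triangular (suc m′ * 1))) (sym (n%1≡0 (c (suc m′) 1)))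
[1+triangular[mn]]%n≡c%n m′ n@(suc (suc n″)) = begin
  (1 + triangular (m * n)) % n        ≡⟨ cong (_% n) (c+multiple≡1+triangular m′ n″) ⟨
  (c m n + X * n) % n                 ≡⟨ [m+kn]%n≡m%n (c m n) X n ⟩
  c m n % n                           ∎
  where
  m X : ℕ
  m = suc m′
  X = n * triangular m′ + m + 1

sameCard : ∀ {A B : Set} {P : A → Set} {Q : B → Set} (f : A → B) (g : B → A) →
           (∀ {x} → P x → Q (f x)) → (∀ {y} → Q y → P (g y)) →
           (∀ {x} → P x → g (f x) ≡ x) → (∀ {y} → Q y → f (g y) ≡ y) →
           SameCard A P B Q
sameCard f g f-pres g-pres g∘f f∘g = record
  { to        = λ (x , px) → f x , f-pres px
  ; from      = λ (y , qy) → g y , g-pres qy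
  ; to-cong   = cong f
  ; from-cong = cong g
  ; inverse   = (λ { {y , qy} refl → f∘g qy }) , (λ { {x , px} refl → g∘f px })
  }

module WordPartition (m′ n′ : ℕ) where

  m n N : ℕ
  m = suc m′
  n = suc n′
  N = m * n

  toPartition : Vec Bool (suc m * n) → Vec ℕ N
  toPartition = partition N

  toWord : Vec ℕ N → Vec Bool (suc m * n)
  toWord l = false ∷ word (n′ + N) n′ l

  InY⇒Decreasing≤ : ∀ {l} → InY m n l → Decreasing≤ n′ l
  InY⇒Decreasing≤ {l} (bound , antitone , _) = lookup⇒Decreasing≤ l bound antitone

  weight-condition : (w : Vec Bool (n′ + N)) → zeros w ≡ n′ → ones w ≡ N →
                     (posSum (false ∷ w) + 1) % n ≡ 0 ⇔ sum (partition N w) % n ≡ c m n % n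
  weight-condition w zeros≡n′ ones≡N = mk⇔ (λ h → trans (to h) 1+T≡c) (λ h → from (trans h (sym 1+T≡c)))
    where
    P S : ℕ
    P = posSum (false ∷ w)
    S = sum (partition N w)
    1+T≡c : (1 + triangular N) % n ≡ c m n % n
    1+T≡c = [1+triangular[mn]]%n≡c%n m′ n
    weight : posSumFrom 1 w + S ≡ N * 1 + triangular N + N * n′
    weight = subst₂ (λ b z → posSumFrom 1 w + sum (partition b w) ≡ b * 1 + triangular b + b * z)
                    ones≡N zeros≡n′ (posSumFrom+sum-partition 1 w)
    swap : ∀ p s → p + 1 + s ≡ p + s + 1
    swap = solve-∀
    collect : ∀ N t n′ → N * 1 + t + N * n′ + 1 ≡ 1 + t + N * suc n′
    collect = solve-∀
    total : P + 1 + S ≡ 1 + triangular N + N * n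
    total = begin
      P + 1 + S                              ≡⟨ swap P S ⟩
      P + S + 1                              ≡⟨ cong (λ p → p + S + 1) (sum-positions≡posSumFrom 0 (false ∷ w)) ⟩
      posSumFrom 1 w + S + 1                 ≡⟨ cong (_+ 1) weight ⟩
      N * 1 + triangular N + N * n′ + 1      ≡⟨ collect N (triangular N) n′ ⟩
      1 + triangular N + N * n               ∎
    open Equivalence (%≡0⇔%≡% (P + 1) S (1 + triangular N) N n total)

  InB⇒InY : ∀ {w} → InB m n w → InY m n (toPartition w)
  InB⇒InY {x ∷ w} (zeros≡n , ones≡N , refl , weight≡0) =
    Decreasing≤⇒lookup≤ _ decreasing , Decreasing≤⇒lookup-antitone _ decreasing ,
    Equivalence.to (weight-condition w (suc-injective zeros≡n) ones≡N) weight≡0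
    where
    decreasing : Decreasing≤ n′ (partition N w)
    decreasing = subst₂ (λ a b → Decreasing≤ a (partition b w)) (suc-injective zeros≡n) ones≡N (partition-decreasing w)

  InY⇒InB : ∀ {l} → InY m n l → InB m n (toWord l)
  InY⇒InB {l} y@(_ , _ , sum≡c) =
    cong suc zeros≡n′ , ones≡N , refl ,
    Equivalence.from (weight-condition w zeros≡n′ ones≡N) (subst (λ v → sum v % n ≡ c m n % n) (sym partition≡l) sum≡c)
    where
    w : Vec Bool (n′ + N)
    w = word (n′ + N) n′ l
    zeros≡n′ : zeros w ≡ n′
    zeros≡n′ = zeros-word (n′ + N) n′ l (InY⇒Decreasing≤ y) (+-comm N n′)
    ones≡N : ones w ≡ N
    ones≡N = ones-word (n′ + N) n′ l (InY⇒Decreasing≤ y) (+-comm N n′)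
    partition≡l : partition N w ≡ l
    partition≡l = partition-word (n′ + N) n′ l (InY⇒Decreasing≤ y) (+-comm N n′)

  toWord∘toPartition : ∀ {w} → InB m n w → toWord (toPartition w) ≡ w
  toWord∘toPartition {x ∷ w} (zeros≡n , ones≡N , refl , _) =
    cong (false ∷_) (subst₂ (λ a b → word (n′ + N) a (partition b w) ≡ w) (suc-injective zeros≡n) ones≡N (word-partition w))

  toPartition∘toWord : ∀ {l} → InY m n l → toPartition (toWord l) ≡ l
  toPartition∘toWord {l} y = partition-word (n′ + N) n′ l (InY⇒Decreasing≤ y) (+-comm N n′)

lemma2p3 : (m n : ℕ) → 1 ≤ m → .{{_ : NonZero n}} → SameCard (Vec Bool (suc m * n)) (InB m n) (Vec ℕ (m * n)) (InY m n)
lemma2p3 zero     _        ()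
lemma2p3 (suc m′) (suc n′) _ =
  sameCard toPartition toWord InB⇒InY InY⇒InB toWord∘toPartition toPartition∘toWord
  where open WordPartition m′ n′
lemma2p3 (suc m′) zero     _ {{n≢0}} = ⊥-elim-irr (NonZero.nonZero n≢0)
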